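{- Let $U=(U_{ij})_{i,j\in I}$ be a nonsingular $\mathcal U$-matrix with supporting tree with root $r$, let $K=I^+$ be the set of leaves below $r^+$ and $U_K=U|_{K\times K}$. Then for $i,j\in K$ with $i\ne j$: $(U^{ -1})_{ij}<0$ if and only if $(U_K^{ -1})_{ij}<0$.
   Context: Trees. $(T,\mathcal J)$ is a finite tree with distinguished root $r$; $\mathrm{geod}(s,t)$ is the shortest path between $s,t$; $s\preceq t$ if $s$ lies on $\mathrm{geod}(t,r)$; $s\wedge t$ is the $\preceq$-largest vertex on both $\mathrm{geod}(s,r)$ and $\mathrm{geod}(t,r)$. Leaves are vertices with no successors (neighbours $s\ne t$ with $t\preceq s$), their set is $I$. Dyadic: every non-leaf $t$ has exactly two successors $t^-,t^+$; each vertex is identified with the set of leaves below it. $\mathcal U$-matrices. A real matrix $U=(U_{ij})_{i,j\in I}$ is a $\mathcal U$-matrix if there exist a dyadic tree with root $r$ and leaf set $I$, a distinguished leaf $n$, and nonnegative vectors $(\alpha_t),(\beta_t)$ on $T$ with: (i) $\alpha_i=\beta_i$ for leaves, and $\alpha_t=\alpha_{t\wedge n}$ for non-leaf $t$ with $r^+\preceq t$; (ii) $\alpha_t\le\beta_t$; (iii) $t\preceq s\Rightarrow\alpha_t\le\alpha_s,\beta_t\le\beta_s$; (iv) for non-leaf $t$ on $\mathrm{geod}(r,n)$, $t^+$ is on $\mathrm{geod}(r,n)$, and $\alpha_t=\beta_t$ on $\mathrm{geod}(r,n)$; (v) $U_{ii}=\alpha_i$, and for $i\ne j$, $t=i\wedge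 j$: $U_{ij}=\alpha_t$ if $i\in t^-,j\in t^+$; $U_{ij}=\beta_s$ if $i\in t^+,j\in t^-$, with $s$ the $\preceq$-larger of $i\wedge j$, $i\wedge n$. $U_K$ is nonsingular whenever $U$ is. -}

module Defs where

open import Level using (0ℓ)
open import Algebra.Bundles using (CommutativeRing)
open import Relation.Binary.Structures using (IsStrictTotalOrder)
open import Relation.Binary.PropositionalEquality using (_≡_)
open import Data.Product using (Σ; ∃; _×_; _,_)
open import Data.Sum using (_⊎_)
open import Relation.Nullary using (¬_)
open import Function.Bundles using (_⇔_)

-- The real numbers, axiomatised as a (Dedekind-)complete ordered field.
-- Any two such structures are isomorphic (classically), so quantifying
-- over all of them is the same as speaking about ℝ.

record RealField : Set₁ where
  field
    commRing : CommutativeRing 0ℓ 0ℓ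
  open CommutativeRing commRing public
  field
    _<_              : Carrier → Carrier → Set
    isStrictTotalOrder : IsStrictTotalOrder _≈_ _<_
    0≉1              : ¬ (0# ≈ 1#)
    inverse          : ∀ x → ¬ (x ≈ 0#) → Σ Carrier (λ y → x * y ≈ 1#)
    +-mono-<         : ∀ {x y} z → x < y → (x + z) < (y + z)
    *-pos            : ∀ {x y} → 0# < x → 0# < y → 0# < (x * y)
  _≤_ : Carrier → Carrier → Set
  x ≤ y = (x < y) ⊎ (x ≈ y)
  field
    complete : (P : Carrier → Set) → Σ Carrier P →
               Σ Carrier (λ b → ∀ x → P x → x ≤ b) →
               Σ Carrier (λ s → (∀ x → P x → x ≤ s) ×
                                (∀ b → (∀ x → P x → x ≤ b) → s ≤ b))

-- Finite (binary/dyadic) rooted trees.  Every non-leaf vertex has exactly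
-- two successors: the left one is t⁻, the right one is t⁺.

data Tree : Set where
  leaf : Tree
  node : Tree → Tree → Tree

data Pos : Tree → Set where
  here  : ∀ {t} → Pos t
  left  : ∀ {l r} → Pos l → Pos (node l r)
  right : ∀ {l r} → Pos r → Pos (node l r)

-- Leaves of a tree (the index set I).
data Leaf : Tree → Set where
  lf  : Leaf leaf
  goL : ∀ {l r} → Leaf l → Leaf (node l r)
  goR : ∀ {l r} → Leaf r → Leaf (node l r)

pos : ∀ {t} → Leaf t → Pos t
pos lf      = here
pos (goL i) = left (pos i)
pos (goR i) = right (pos i)

IsLeafVertex : ∀ {t} → Pos t → Set
IsLeafVertex {t} p = Σ (Leaf t) (λ i → pos i ≡ p)

-- s ⪯ t : s lies on geod(t, r)
data _⪯_ : ∀ {t} → Pos t → Pos t → Set where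
  here⪯  : ∀ {t} {p : Pos t} → here ⪯ p
  left⪯  : ∀ {l r} {p q : Pos l} → p ⪯ q → _⪯_ {node l r} (left p) (left q)
  right⪯ : ∀ {l r} {p q : Pos r} → p ⪯ q → _⪯_ {node l r} (right p) (right q)

-- s ∧ t : the ⪯-largest common vertex of geod(s,r) and geod(t,r)
_∧_ : ∀ {t} → Pos t → Pos t → Pos t
left p  ∧ left q  = left (p ∧ q)
right p ∧ right q = right (p ∧ q)
_       ∧ _       = here

-- Succ⁻ t c : c = t⁻ ;  Succ⁺ t c : c = t⁺
data Succ⁻ : ∀ {t} → Pos t → Pos t → Set where
  s⁻-here  : ∀ {l r} → Succ⁻ {node l r} here (left here)
  s⁻-left  : ∀ {l r} {p q : Pos l} → Succ⁻ p q → Succ⁻ {node l r} (left p) (left q)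
  s⁻-right : ∀ {l r} {p q : Pos r} → Succ⁻ p q → Succ⁻ {node l r} (right p) (right q)

data Succ⁺ : ∀ {t} → Pos t → Pos t → Set where
  s⁺-here  : ∀ {l r} → Succ⁺ {node l r} here (right here)
  s⁺-left  : ∀ {l r} {p q : Pos l} → Succ⁺ p q → Succ⁺ {node l r} (left p) (left q)
  s⁺-right : ∀ {l r} {p q : Pos r} → Succ⁺ p q → Succ⁺ {node l r} (right p) (right q)

module WithField (F : RealField) where
  open RealField F public

  Mat : Tree → Set
  Mat t = Leaf t → Leaf t → Carrier

  Σ[_] : ∀ t → (Leaf t → Carrier) → Carrier
  Σ[ leaf ]     f = f lf
  Σ[ node l r ] f = Σ[ l ] (λ i → f (goL i)) + Σ[ r ] (λ i → f (goR i))

  _·_ : ∀ {t} → Mat t → Mat t → Mat t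
  _·_ {t} A B i j = Σ[ t ] (λ k → A i k * B k j)

  idMat : ∀ {t} → Mat t
  idMat lf      lf      = 1#
  idMat (goL i) (goL j) = idMat i j
  idMat (goR i) (goR j) = idMat i j
  idMat _       _       = 0#

  IsInverse : ∀ {t} → Mat t → Mat t → Set
  IsInverse U V = (∀ i j → (U · V) i j ≈ idMat i j) × (∀ i j → (V · U) i j ≈ idMat i j)

  Nonsingular : ∀ {t} → Mat t → Set
  Nonsingular {t} U = Σ (Mat t) (IsInverse U)

  -- U is the 𝒰-matrix determined by the dyadic tree node L R (root r,
  -- r⁻ = root of L, r⁺ = root of R), the distinguished leaf n and the
  -- vectors α, β, i.e. conditions (nonnegativity), (i)–(v).
  record IsUMatrix (L R : Tree) (n : Leaf (node L R))
                   (α β : Pos (node L R) → Carrier) (U : Mat (node L R)) : Set where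
    field
      α-nonneg : ∀ t → 0# ≤ α t
      β-nonneg : ∀ t → 0# ≤ β t
      i-leaf   : ∀ (i : Leaf (node L R)) → α (pos i) ≈ β (pos i)
      i-r⁺     : ∀ t → ¬ IsLeafVertex t → right here ⪯ t → α t ≈ α (t ∧ pos n)
      ii       : ∀ t → α t ≤ β t
      iii-α    : ∀ t s → t ⪯ s → α t ≤ α s
      iii-β    : ∀ t s → t ⪯ s → β t ≤ β s
      iv-succ  : ∀ t c → t ⪯ pos n → Succ⁺ t c → c ⪯ pos n
      iv-eq    : ∀ t → t ⪯ pos n → α t ≈ β t
      v-diag   : ∀ i → U i i ≈ α (pos i)
      v-α      : ∀ i j c⁻ c⁺ → Succ⁻ (pos i ∧ pos j) c⁻ → c⁻ ⪯ pos i →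
                 Succ⁺ (pos i ∧ pos j) c⁺ → c⁺ ⪯ pos j → U i j ≈ α (pos i ∧ pos j)
      v-β      : ∀ i j c⁻ c⁺ → Succ⁺ (pos i ∧ pos j) c⁺ → c⁺ ⪯ pos i →
                 Succ⁻ (pos i ∧ pos j) c⁻ → c⁻ ⪯ pos j →
                 ∀ s → (pos i ∧ pos j) ⪯ s → (pos i ∧ pos n) ⪯ s →
                 (s ≡ (pos i ∧ pos j)) ⊎ (s ≡ (pos i ∧ pos n)) →
                 U i j ≈ β s

  restrict⁺ : ∀ {L R} → Mat (node L R) → Mat R
  restrict⁺ U i j = U (goR i) (goR j)

module Submission where

open import Defs
open import Data.Empty using (⊥-elim)
open import Data.Product using (_,_)
open import Data.Sum using (inj₂)
open import Function.Bundles using (_⇔_; mk⇔)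
open import Relation.Binary.PropositionalEquality as ≡ using (_≡_; _≢_)
open import Relation.Binary.Structures using (IsStrictTotalOrder)
open import Relation.Nullary using (Dec; yes; no)
import Algebra.Properties.Ring as RingProperties
import Algebra.Properties.CommutativeSemigroup as CommutativeSemigroupProperties
import Relation.Binary.Reasoning.Setoid as SetoidReasoning

-- Condition (iv) forces the distinguished leaf n to be the rightmost leaf of
-- the tree, so n lies in K = I⁺; write m for n seen as a leaf of R.  Reading
-- off (v) along the right spine, the 𝒰-matrix U = [A B; D C] (rows and columns
-- split into I⁻ and K) has B constant, every column of D equal to the m-th column
-- of C, and the m-th row of C constant.  Put x := 1ᵀV₁₂ and W := C⁻¹.  The
-- K-rows of UV = 1 become C (e_m xᵀ + V₂₂) = 1, so V₂₂ = W − e_m xᵀ.  The m-th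
-- row of VU = 1 then gives xᵀC = (const)·1ᵀ, hence xᵀ is a multiple of 1ᵀW,
-- which is a multiple of e_mᵀ because the m-th row of C is constant.  Thus
-- x_q = 0 for q ≠ m, and V₂₂ agrees with W off the diagonal.

⪯-refl : ∀ {t} (p : Pos t) → p ⪯ p
⪯-refl here      = here⪯
⪯-refl (left p)  = left⪯ (⪯-refl p)
⪯-refl (right p) = right⪯ (⪯-refl p)

∧-idem : ∀ {t} (p : Pos t) → p ∧ p ≡ p
∧-idem here      = ≡.refl
∧-idem (left p)  = ≡.cong left (∧-idem p)
∧-idem (right p) = ≡.cong right (∧-idem p)

∧-comm : ∀ {t} (p q : Pos t) → p ∧ q ≡ q ∧ p
∧-comm here      here      = ≡.refl
∧-comm here      (left q)  = ≡.refl
∧-comm here      (right q) = ≡.refl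
∧-comm (left p)  here      = ≡.refl
∧-comm (right p) here      = ≡.refl
∧-comm (left p)  (left q)  = ≡.cong left (∧-comm p q)
∧-comm (right p) (right q) = ≡.cong right (∧-comm p q)
∧-comm (left p)  (right q) = ≡.refl
∧-comm (right p) (left q)  = ≡.refl

∧-⪯ˡ : ∀ {t} (p q : Pos t) → (p ∧ q) ⪯ p
∧-⪯ˡ here      q         = here⪯
∧-⪯ˡ (left p)  here      = here⪯
∧-⪯ˡ (right p) here      = here⪯
∧-⪯ˡ (left p)  (left q)  = left⪯ (∧-⪯ˡ p q)
∧-⪯ˡ (right p) (right q) = right⪯ (∧-⪯ˡ p q)
∧-⪯ˡ (left p)  (right q) = here⪯
∧-⪯ˡ (right p) (left q)  = here⪯

∧-⪯ʳ : ∀ {t} (p q : Pos t) → (p ∧ q) ⪯ q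
∧-⪯ʳ p q = ≡.subst (_⪯ q) (∧-comm q p) (∧-⪯ˡ q p)

_≟_ : ∀ {t} (i j : Leaf t) → Dec (i ≡ j)
lf    ≟ lf    = yes ≡.refl
goL i ≟ goL j with i ≟ j
... | yes ≡.refl = yes ≡.refl
... | no i≢j     = no λ { ≡.refl → i≢j ≡.refl }
goR i ≟ goR j with i ≟ j
... | yes ≡.refl = yes ≡.refl
... | no i≢j     = no λ { ≡.refl → i≢j ≡.refl }
goL i ≟ goR j = no λ ()
goR i ≟ goL j = no λ ()

data Fork {t} (v p q : Pos t) : Set where
  fork : ∀ {c⁻ c⁺} → Succ⁻ v c⁻ → c⁻ ⪯ p → Succ⁺ v c⁺ → c⁺ ⪯ q → Fork v p q

fork-root : ∀ {l r} (p : Pos l) (q : Pos r) → Fork {node l r} here (left p) (right q)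
fork-root p q = fork s⁻-here (left⪯ here⪯) s⁺-here (right⪯ here⪯)

fork-right : ∀ {l r} {v p q : Pos r} → Fork v p q → Fork {node l r} (right v) (right p) (right q)
fork-right (fork s⁻ c⁻⪯p s⁺ c⁺⪯q) = fork (s⁻-right s⁻) (right⪯ c⁻⪯p) (s⁺-right s⁺) (right⪯ c⁺⪯q)

data IsRightmost : ∀ {t} → Leaf t → Set where
  rightmost-lf  : IsRightmost lf
  rightmost-goR : ∀ {l r} {m : Leaf r} → IsRightmost m → IsRightmost (goR {l} m)

SpineClosed⁺ : ∀ {t} → Leaf t → Set
SpineClosed⁺ {t} n = ∀ (s c : Pos t) → s ⪯ pos n → Succ⁺ s c → c ⪯ pos n

spineClosed⁺⇒rightmost : ∀ {t} (n : Leaf t) → SpineClosed⁺ n → IsRightmost n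
spineClosed⁺⇒rightmost lf      closed = rightmost-lf
spineClosed⁺⇒rightmost (goL n) closed with closed here (right here) here⪯ s⁺-here
... | ()
spineClosed⁺⇒rightmost (goR n) closed =
  rightmost-goR (spineClosed⁺⇒rightmost n λ s c s⪯n s⁺ →
    unright (closed (right s) (right c) (right⪯ s⪯n) (s⁺-right s⁺)))
  where
  unright : ∀ {l r} {p q : Pos r} → _⪯_ {node l r} (right p) (right q) → p ⪯ q
  unright (right⪯ p⪯q) = p⪯q

fork-rightmost : ∀ {t} {i n : Leaf t} → IsRightmost n → i ≢ n → Fork (pos i ∧ pos n) (pos i) (pos n)
fork-rightmost {i = lf}    rightmost-lf       i≢n = ⊥-elim (i≢n ≡.refl)
fork-rightmost {i = goL i} (rightmost-goR _)  i≢n = fork-root (pos i) _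
fork-rightmost {i = goR i} (rightmost-goR rm) i≢n =
  fork-right (fork-rightmost rm (λ i≡n → i≢n (≡.cong goR i≡n)))

module UMatrixEntries (F : RealField) {L R : Tree} {n : Leaf (node L R)}
  {α β : Pos (node L R) → WithField.Carrier F} {U : WithField.Mat F (node L R)}
  (isU : WithField.IsUMatrix F L R n α β U) where

  open WithField F
  open IsUMatrix isU

  rightmost : IsRightmost n
  rightmost = spineClosed⁺⇒rightmost n iv-succ

  entry-left-of-fork : ∀ i j → Fork (pos i ∧ pos j) (pos i) (pos j) → U i j ≈ α (pos i ∧ pos j)
  entry-left-of-fork i j (fork s⁻ c⁻⪯i s⁺ c⁺⪯j) = v-α i j _ _ s⁻ c⁻⪯i s⁺ c⁺⪯j

  column-n : ∀ i → U i n ≈ α (pos i ∧ pos n)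
  column-n i with i ≟ n
  ... | yes ≡.refl = trans (v-diag n) (reflexive (≡.cong α (≡.sym (∧-idem (pos n)))))
  ... | no i≢n = entry-left-of-fork i n (fork-rightmost rightmost i≢n)

  -- β agrees with α on the spine geod(r, n), where (v) reads β at i ∧ n.
  entry-right-of-fork : ∀ i j → Fork (pos i ∧ pos j) (pos j) (pos i) →
    (pos i ∧ pos j) ⪯ (pos i ∧ pos n) → U i j ≈ α (pos i ∧ pos n)
  entry-right-of-fork i j (fork s⁻ c⁻⪯j s⁺ c⁺⪯i) i∧j⪯i∧n =
    trans (v-β i j _ _ s⁺ c⁺⪯i s⁻ c⁻⪯j (pos i ∧ pos n) i∧j⪯i∧n (⪯-refl _) (inj₂ ≡.refl))
          (sym (iv-eq _ (∧-⪯ʳ (pos i) (pos n))))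

  lower-left≈column-n : ∀ i ℓ → U (goR i) (goL ℓ) ≈ U (goR i) n
  lower-left≈column-n i ℓ =
    trans (entry-right-of-fork (goR i) (goL ℓ) (fork-root (pos ℓ) (pos i)) here⪯)
          (sym (column-n (goR i)))

  row-n-constant : ∀ k → U n k ≈ U n n
  row-n-constant k with k ≟ n
  ... | yes ≡.refl = refl
  ... | no k≢n = trans (entry-right-of-fork n k n∧k-fork n∧k⪯n∧n) (sym (column-n n))
    where
    n∧k-fork : Fork (pos n ∧ pos k) (pos k) (pos n)
    n∧k-fork = ≡.subst (λ v → Fork v (pos k) (pos n)) (∧-comm (pos k) (pos n))
                       (fork-rightmost rightmost k≢n)
    n∧k⪯n∧n : (pos n ∧ pos k) ⪯ (pos n ∧ pos n)
    n∧k⪯n∧n = ≡.subst ((pos n ∧ pos k) ⪯_) (≡.sym (∧-idem (pos n))) (∧-⪯ˡ (pos n) (pos k))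

  upper-right-constant : ∀ ℓ j → U (goL ℓ) (goR j) ≈ α here
  upper-right-constant ℓ j = entry-left-of-fork (goL ℓ) (goR j) (fork-root (pos ℓ) (pos j))

module FiniteSums (F : RealField) where

  open WithField F
  open SetoidReasoning setoid
  open CommutativeSemigroupProperties +-commutativeSemigroup using (interchange)

  Σ-cong : ∀ t {f g : Leaf t → Carrier} → (∀ i → f i ≈ g i) → Σ[ t ] f ≈ Σ[ t ] g
  Σ-cong leaf       f≈g = f≈g lf
  Σ-cong (node l r) f≈g = +-cong (Σ-cong l (λ i → f≈g (goL i))) (Σ-cong r (λ i → f≈g (goR i)))

  Σ-distrib-+ : ∀ t (f g : Leaf t → Carrier) → Σ[ t ] (λ i → f i + g i) ≈ Σ[ t ] f + Σ[ t ] g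
  Σ-distrib-+ leaf       f g = refl
  Σ-distrib-+ (node l r) f g =
    trans (+-cong (Σ-distrib-+ l _ _) (Σ-distrib-+ r _ _)) (interchange _ _ _ _)

  *-distribˡ-Σ : ∀ t c (f : Leaf t → Carrier) → c * Σ[ t ] f ≈ Σ[ t ] (λ i → c * f i)
  *-distribˡ-Σ leaf       c f = refl
  *-distribˡ-Σ (node l r) c f = trans (distribˡ c _ _) (+-cong (*-distribˡ-Σ l c _) (*-distribˡ-Σ r c _))

  *-distribʳ-Σ : ∀ t c (f : Leaf t → Carrier) → Σ[ t ] f * c ≈ Σ[ t ] (λ i → f i * c)
  *-distribʳ-Σ leaf       c f = refl
  *-distribʳ-Σ (node l r) c f = trans (distribʳ c _ _) (+-cong (*-distribʳ-Σ l c _) (*-distribʳ-Σ r c _))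

  Σ-zero : ∀ t → Σ[ t ] (λ _ → 0#) ≈ 0#
  Σ-zero leaf       = refl
  Σ-zero (node l r) = trans (+-cong (Σ-zero l) (Σ-zero r)) (+-identityˡ 0#)

  Σ-zeroˡ : ∀ t (f : Leaf t → Carrier) → Σ[ t ] (λ i → 0# * f i) ≈ 0#
  Σ-zeroˡ t f = trans (Σ-cong t (λ i → zeroˡ (f i))) (Σ-zero t)

  Σ-comm : ∀ s t (f : Leaf s → Leaf t → Carrier) →
    Σ[ s ] (λ i → Σ[ t ] (f i)) ≈ Σ[ t ] (λ k → Σ[ s ] (λ i → f i k))
  Σ-comm leaf       t f = refl
  Σ-comm (node l r) t f =
    trans (+-cong (Σ-comm l t _) (Σ-comm r t _)) (sym (Σ-distrib-+ t _ _))

  Σ-assoc : ∀ s t (a : Leaf s → Carrier) (B : Leaf s → Leaf t → Carrier) (g : Leaf t → Carrier) →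
    Σ[ s ] (λ i → a i * Σ[ t ] (λ k → B i k * g k)) ≈ Σ[ t ] (λ k → Σ[ s ] (λ i → a i * B i k) * g k)
  Σ-assoc s t a B g = begin
      Σ[ s ] (λ i → a i * Σ[ t ] (λ k → B i k * g k))
    ≈⟨ Σ-cong s (λ i → *-distribˡ-Σ t (a i) _) ⟩
      Σ[ s ] (λ i → Σ[ t ] (λ k → a i * (B i k * g k)))
    ≈⟨ Σ-cong s (λ i → Σ-cong t (λ k → sym (*-assoc _ _ _))) ⟩
      Σ[ s ] (λ i → Σ[ t ] (λ k → (a i * B i k) * g k))
    ≈⟨ Σ-comm s t _ ⟩
      Σ[ t ] (λ k → Σ[ s ] (λ i → (a i * B i k) * g k))
    ≈⟨ Σ-cong t (λ k → sym (*-distribʳ-Σ s (g k) _)) ⟩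
      Σ[ t ] (λ k → Σ[ s ] (λ i → a i * B i k) * g k) ∎

  idMat-diag : ∀ {t} (i : Leaf t) → idMat i i ≈ 1#
  idMat-diag lf      = refl
  idMat-diag (goL i) = idMat-diag i
  idMat-diag (goR i) = idMat-diag i

  idMat-≢ : ∀ {t} (i j : Leaf t) → i ≢ j → idMat i j ≈ 0#
  idMat-≢ lf      lf      i≢j = ⊥-elim (i≢j ≡.refl)
  idMat-≢ (goL i) (goL j) i≢j = idMat-≢ i j (λ i≡j → i≢j (≡.cong goL i≡j))
  idMat-≢ (goR i) (goR j) i≢j = idMat-≢ i j (λ i≡j → i≢j (≡.cong goR i≡j))
  idMat-≢ (goL i) (goR j) i≢j = refl
  idMat-≢ (goR i) (goL j) i≢j = refl

  idMat-sym : ∀ {t} (i j : Leaf t) → idMat i j ≡ idMat j i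
  idMat-sym lf      lf      = ≡.refl
  idMat-sym (goL i) (goL j) = idMat-sym i j
  idMat-sym (goR i) (goR j) = idMat-sym i j
  idMat-sym (goL i) (goR j) = ≡.refl
  idMat-sym (goR i) (goL j) = ≡.refl

  Σ-idMatˡ : ∀ t (p : Leaf t) (f : Leaf t → Carrier) → Σ[ t ] (λ k → idMat p k * f k) ≈ f p
  Σ-idMatˡ leaf       lf      f = *-identityˡ (f lf)
  Σ-idMatˡ (node l r) (goL p) f =
    trans (+-cong (Σ-idMatˡ l p _) (Σ-zeroˡ r _)) (+-identityʳ _)
  Σ-idMatˡ (node l r) (goR p) f =
    trans (+-cong (Σ-zeroˡ l _) (Σ-idMatˡ r p _)) (+-identityˡ _)

  Σ-idMatʳ : ∀ t (p : Leaf t) (f : Leaf t → Carrier) → Σ[ t ] (λ k → f k * idMat k p) ≈ f p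
  Σ-idMatʳ t p f = trans (Σ-cong t flip) (Σ-idMatˡ t p f)
    where
    flip : ∀ k → f k * idMat k p ≈ idMat p k * f k
    flip k = trans (*-comm _ _) (reflexive (≡.cong (_* f k) (idMat-sym k p)))

module BlockInverse (F : RealField) where

  open WithField F
  open FiniteSums F
  open SetoidReasoning setoid
  open RingProperties ring using (+-cancelʳ)

  leftInverse-cancel : ∀ {t} {C W : Mat t} → (∀ i j → (W · C) i j ≈ idMat i j) →
    ∀ p (v : Leaf t → Carrier) → Σ[ t ] (λ i → W p i * Σ[ t ] (λ k → C i k * v k)) ≈ v p
  leftInverse-cancel {t} {C} {W} WC p v =
    trans (Σ-assoc t t (W p) C v) (trans (Σ-cong t (λ k → *-cong (WC p k) refl)) (Σ-idMatˡ t p v))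

  rightInverse-cancel : ∀ {t} {C W : Mat t} → (∀ i j → (C · W) i j ≈ idMat i j) →
    ∀ q (u : Leaf t → Carrier) → Σ[ t ] (λ j → Σ[ t ] (λ k → u k * C k j) * W j q) ≈ u q
  rightInverse-cancel {t} {C} {W} CW q u =
    trans (sym (Σ-assoc t t u C (λ j → W j q)))
          (trans (Σ-cong t (λ k → *-cong refl (CW k q))) (Σ-idMatʳ t q u))

  -- c · Σⱼ W_{jq} = (C W)_{mq}, and q = m shows that c is invertible.
  columnSum-rightInverse : ∀ {t} {C W : Mat t} → (∀ i j → (C · W) i j ≈ idMat i j) →
    (m : Leaf t) → (∀ j → C m j ≈ C m m) → ∀ q → q ≢ m → Σ[ t ] (λ j → W j q) ≈ 0#
  columnSum-rightInverse {t} {C} {W} CW m row-m q q≢m = begin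
      s q                  ≈⟨ *-identityʳ (s q) ⟨
      s q * 1#             ≈⟨ *-cong refl (trans (sym (idMat-diag m)) (sym (c*s≈δ m))) ⟩
      s q * (c * s m)      ≈⟨ *-assoc _ _ _ ⟨
      (s q * c) * s m      ≈⟨ *-cong (*-comm _ _) refl ⟩
      (c * s q) * s m      ≈⟨ *-comm _ _ ⟩
      s m * (c * s q)      ≈⟨ *-cong refl (trans (c*s≈δ q) (idMat-≢ m q (λ m≡q → q≢m (≡.sym m≡q)))) ⟩
      s m * 0#             ≈⟨ zeroʳ _ ⟩
      0#                   ∎
    where
    c : Carrier
    c = C m m
    s : Leaf t → Carrier
    s q = Σ[ t ] (λ j → W j q)
    c*s≈δ : ∀ q → c * s q ≈ idMat m q
    c*s≈δ q = trans (*-distribˡ-Σ t c _)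
                    (trans (Σ-cong t (λ j → *-cong (sym (row-m j)) refl)) (CW m q))

  inverse-restrict⁺-offDiagonal : ∀ {L R} (U V : Mat (node L R)) → IsInverse U V →
    (W : Mat R) → IsInverse (restrict⁺ U) W → (m : Leaf R) (a : Carrier) →
    (∀ i ℓ → U (goR i) (goL ℓ) ≈ U (goR i) (goR m)) →
    (∀ j → U (goR m) (goR j) ≈ U (goR m) (goR m)) →
    (∀ ℓ j → U (goL ℓ) (goR j) ≈ a) →
    ∀ p q → p ≢ q → V (goR p) (goR q) ≈ W p q
  inverse-restrict⁺-offDiagonal {L} {R} U V (UV , VU) W (CW , WC) m a
    lower-left row-m upper-right p q p≢q =
    trans (sym (trans (+-cong (correction-vanishes p q p≢q) refl) (+-identityˡ _)))
          (V₂₂-via-W p q)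
    where
    C : Mat R
    C = restrict⁺ U
    V₂₂ : Mat R
    V₂₂ i j = V (goR i) (goR j)
    x : Leaf R → Carrier
    x j = Σ[ L ] (λ ℓ → V (goL ℓ) (goR j))
    y : Carrier
    y = Σ[ L ] (λ ℓ → V (goR m) (goL ℓ))

    UV-lower : ∀ i j → C i m * x j + Σ[ R ] (λ k → C i k * V₂₂ k j) ≈ idMat i j
    UV-lower i j = trans (+-cong Cx≈UV₁₂ refl) (UV (goR i) (goR j))
      where
      Cx≈UV₁₂ : C i m * x j ≈ Σ[ L ] (λ ℓ → U (goR i) (goL ℓ) * V (goL ℓ) (goR j))
      Cx≈UV₁₂ = trans (*-distribˡ-Σ L _ _) (Σ-cong L (λ ℓ → *-cong (sym (lower-left i ℓ)) refl))

    V₂₂-via-W : ∀ p j → idMat p m * x j + V₂₂ p j ≈ W p j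
    V₂₂-via-W p j = begin
        idMat p m * x j + V₂₂ p j
      ≈⟨ +-cong (*-cong (WC p m) refl) (leftInverse-cancel WC p (λ k → V₂₂ k j)) ⟨
        Σ[ R ] (λ i → W p i * C i m) * x j + Σ[ R ] (λ i → W p i * Σ[ R ] (λ k → C i k * V₂₂ k j))
      ≈⟨ +-cong (trans (*-distribʳ-Σ R (x j) _) (Σ-cong R (λ i → *-assoc _ _ _))) refl ⟩
        Σ[ R ] (λ i → W p i * (C i m * x j)) + Σ[ R ] (λ i → W p i * Σ[ R ] (λ k → C i k * V₂₂ k j))
      ≈⟨ Σ-distrib-+ R _ _ ⟨
        Σ[ R ] (λ i → W p i * (C i m * x j) + W p i * Σ[ R ] (λ k → C i k * V₂₂ k j))
      ≈⟨ Σ-cong R (λ i → trans (sym (distribˡ _ _ _)) (*-cong refl (UV-lower i j))) ⟩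
        Σ[ R ] (λ i → W p i * idMat i j)
      ≈⟨ Σ-idMatʳ R j (W p) ⟩
        W p j ∎

    VU-row-m : ∀ j → y * a + Σ[ R ] (λ k → V₂₂ m k * C k j) ≈ idMat m j
    VU-row-m j = trans (+-cong ya≈VU₂₁ refl) (VU (goR m) (goR j))
      where
      ya≈VU₂₁ : y * a ≈ Σ[ L ] (λ ℓ → V (goR m) (goL ℓ) * U (goL ℓ) (goR j))
      ya≈VU₂₁ = trans (*-distribʳ-Σ L a _) (Σ-cong L (λ ℓ → *-cong refl (sym (upper-right ℓ j))))

    xC-constant : ∀ j → Σ[ R ] (λ k → x k * C k j) ≈ y * a
    xC-constant j = +-cancelʳ (Σ[ R ] (λ k → V₂₂ m k * C k j)) _ _ (trans xC+VC≈δ (sym (VU-row-m j)))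
      where
      x+V₂₂≈W : ∀ k → x k + V₂₂ m k ≈ W m k
      x+V₂₂≈W k = trans (+-cong (sym (trans (*-cong (idMat-diag m) refl) (*-identityˡ _))) refl)
                        (V₂₂-via-W m k)
      xC+VC≈δ : Σ[ R ] (λ k → x k * C k j) + Σ[ R ] (λ k → V₂₂ m k * C k j) ≈ idMat m j
      xC+VC≈δ = begin
          Σ[ R ] (λ k → x k * C k j) + Σ[ R ] (λ k → V₂₂ m k * C k j)
        ≈⟨ Σ-distrib-+ R _ _ ⟨
          Σ[ R ] (λ k → x k * C k j + V₂₂ m k * C k j)
        ≈⟨ Σ-cong R (λ k → trans (sym (distribʳ _ _ _)) (*-cong (x+V₂₂≈W k) refl)) ⟩
          Σ[ R ] (λ k → W m k * C k j)
        ≈⟨ WC m j ⟩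
          idMat m j ∎

    x-vanishes : ∀ q → q ≢ m → x q ≈ 0#
    x-vanishes q q≢m = begin
        x q
      ≈⟨ rightInverse-cancel CW q x ⟨
        Σ[ R ] (λ j → Σ[ R ] (λ k → x k * C k j) * W j q)
      ≈⟨ Σ-cong R (λ j → *-cong (xC-constant j) refl) ⟩
        Σ[ R ] (λ j → (y * a) * W j q)
      ≈⟨ *-distribˡ-Σ R (y * a) _ ⟨
        (y * a) * Σ[ R ] (λ j → W j q)
      ≈⟨ *-cong refl (columnSum-rightInverse CW m row-m q q≢m) ⟩
        (y * a) * 0#
      ≈⟨ zeroʳ _ ⟩
        0# ∎

    correction-vanishes : ∀ i j → i ≢ j → idMat i m * x j ≈ 0#
    correction-vanishes i j i≢j with i ≟ m
    ... | no i≢m     = trans (*-cong (idMat-≢ i m i≢m) refl) (zeroˡ _)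
    ... | yes ≡.refl = trans (*-cong refl (x-vanishes j (λ j≡i → i≢j (≡.sym j≡i)))) (zeroʳ _)

lemma4p3 : (F : RealField) → let open WithField F in
    (L R : Tree) (n : Leaf (node L R)) (α β : Pos (node L R) → Carrier)
    (U : Mat (node L R)) → IsUMatrix L R n α β U → Nonsingular U →
    (V : Mat (node L R)) → IsInverse U V →
    (W : Mat R) → IsInverse (restrict⁺ U) W →
    (i j : Leaf R) → i ≢ j →
    ((V (goR i) (goR j) < 0#) ⇔ (W i j < 0#))
lemma4p3 F L R n α β U isU _ V V-inverse W W-inverse i j i≢j
  with spineClosed⁺⇒rightmost n (WithField.IsUMatrix.iv-succ isU)
... | rightmost-goR {m = m} _ = mk⇔ (<-respˡ-≈ V≈W) (<-respˡ-≈ (sym V≈W))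
  where
  open WithField F
  open IsStrictTotalOrder isStrictTotalOrder using (<-respˡ-≈)
  open UMatrixEntries F isU
  V≈W : V (goR i) (goR j) ≈ W i j
  V≈W = BlockInverse.inverse-restrict⁺-offDiagonal F U V V-inverse W W-inverse m (α here)
          lower-left≈column-n (λ k → row-n-constant (goR k)) upper-right-constant i j i≢j
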